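{- 1. Let $k\ge 2$ be an integer. For all nonnegative integers $m,n$ with $2m+n=2^k$ there is a perfect $2^k$-coloring of $D(m,n)$ with quotient matrix $3J$. 2. Let $k\ge 2$ be an integer. For all nonnegative integers $m,n$ with $2m+n=2^k-1$, where $k\ne 3$ if $m>0$, there is a perfect $2^k$-coloring of $D(m,n)$ with quotient matrix $3(J-E)$.
   Context: The Shrikhande graph is the Cayley graph on $\mathbb{Z}_4^2$ with connection set $\{01,03,10,30,11,33\}$. For nonnegative integers $m,n$, $D(m,n)$ is the Cartesian product of $m$ copies of the Shrikhande graph and $n$ copies of $K_4$ (vertex set $(\mathbb{Z}_4^2)^m\times\mathbb{Z}_4^n$; adjacent iff differing in exactly one coordinate by an adjacency of that factor). A $k$-coloring is a surjective map onto a $k$-element color set; it is perfect with quotient matrix $S=(s_{ij})$ if every vertex of color $i$ has exactly $s_{ij}$ neighbours of color $j$. $J$ is the all-ones and $E$ the identity $2^k\times 2^k$ matrix. -}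

module Defs where

open import Data.Nat using (ℕ; zero; suc; _+_; _*_; _^_; _∸_; _≤_; _<_)
open import Data.Nat.DivMod using (_mod_)
open import Data.Fin using (Fin; toℕ; zero; suc; _≟_)
open import Data.Fin.Patterns using (0F; 1F; 2F; 3F)
open import Data.Product using (_×_; _,_; proj₁; proj₂; ∃)
open import Data.List using (List; []; _∷_; map; concatMap; filter; length; allFin)
open import Relation.Binary.PropositionalEquality using (_≡_)
open import Relation.Nullary using (does)
open import Data.Bool using (if_then_else_)

Z4 : Set
Z4 = Fin 4

_+₄_ : Z4 → Z4 → Z4
a +₄ b = (toℕ a + toℕ b) mod 4

Z4² : Set
Z4² = Z4 × Z4

_+₄²_ : Z4² → Z4² → Z4²
(a , b) +₄² (c , d) = (a +₄ c , b +₄ d)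

shrikhandeGens : List Z4²
shrikhandeGens = (0F , 1F) ∷ (0F , 3F) ∷ (1F , 0F) ∷ (3F , 0F) ∷ (1F , 1F) ∷ (3F , 3F) ∷ []

k4Gens : List Z4
k4Gens = 1F ∷ 2F ∷ 3F ∷ []

Vertex : ℕ → ℕ → Set
Vertex m n = (Fin m → Z4²) × (Fin n → Z4)

update : {A : Set} {k : ℕ} → (Fin k → A) → Fin k → (A → A) → Fin k → A
update f i g j = if does (i ≟ j) then g (f j) else f j

-- the list of neighbours of a vertex of D(m,n): change exactly one coordinate
-- by an adjacency of that factor (each neighbour appears exactly once)
neighbours : (m n : ℕ) → Vertex m n → List (Vertex m n)
neighbours m n (x , y) =
  concatMap (λ i → map (λ s → (update x i (_+₄² s) , y)) shrikhandeGens) (allFin m)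
  Data.List.++
  concatMap (λ i → map (λ t → (x , update y i (_+₄ t))) k4Gens) (allFin n)

nbrCount : {m n K : ℕ} → (Vertex m n → Fin K) → Vertex m n → Fin K → ℕ
nbrCount {m} {n} c v j = length (filter (λ w → c w ≟ j) (neighbours m n v))

IsPerfectColoring : (m n K : ℕ) → (Vertex m n → Fin K) → (Fin K → Fin K → ℕ) → Set
IsPerfectColoring m n K c S =
  (∀ (j : Fin K) → ∃ λ (v : Vertex m n) → c v ≡ j) ×
  (∀ (v : Vertex m n) (j : Fin K) → nbrCount c v j ≡ S (c v) j)

threeJ : {K : ℕ} → Fin K → Fin K → ℕ
threeJ i j = 3

threeJminusE : {K : ℕ} → Fin K → Fin K → ℕ
threeJminusE i j = if does (i ≟ j) then 0 else 3

module Submission where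

open import Defs
open import Data.Nat using (ℕ; _+_; _*_; _^_; _∸_; _≤_; _<_)
open import Data.Fin using (Fin)
open import Data.Product using (_×_; ∃)
open import Relation.Binary.PropositionalEquality using (_≡_; _≢_)

open import Data.Bool using (Bool; true; false; _xor_; if_then_else_)
open import Data.Bool.Properties using (xor-assoc; xor-comm; xor-identityˡ; xor-identityʳ; xor-same)
import Data.Bool.Properties as Bool
open import Data.Empty using (⊥-elim)
open import Data.Fin using (zero; suc; combine; remQuot; _≟_)
open import Data.Fin.Patterns using (0F; 1F; 2F; 3F)
open import Data.Fin.Properties using (remQuot-combine; combine-remQuot; 2↔Bool)
open import Data.List using (List; []; _∷_; map; concatMap; allFin; tabulate; lookup; length; filter; take; drop)
import Data.List as List
open import Data.List.Properties
  using (map-++; map-∘; map-cong; map-tabulate; tabulate-lookup; take++drop≡id; length-take; length-drop; length-++)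
open import Data.List.Relation.Binary.Permutation.Propositional using (_↭_; ↭-refl; ↭-prep; ↭-swap; ↭-sym)
open import Data.List.Relation.Binary.Permutation.Propositional.Properties using (map⁺; shift)
open import Data.Nat using (zero; suc; z≤n; s≤s)
open import Data.Nat.ListAction using (sum)
open import Data.Nat.ListAction.Properties using (sum-++; sum-↭)
open import Data.Nat.Properties using (+-assoc; +-identityʳ; *-suc; suc-injective; m≤n⇒m⊓n≡m; ≤-refl)
open import Data.Nat.Tactic.RingSolver using (solve-∀)
open import Data.Product using (_,_; proj₁; proj₂)
open import Data.Vec using (Vec; []; _∷_; zipWith; replicate; _++_)
open import Data.Vec.Properties using (≡-dec; zipWith-++)
import Data.Vec.Relation.Binary.Pointwise.Inductive as Pointwise
open import Function using (_∘_; _⇔_; mk⇔; Equivalence; Inverse)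
open import Level using (0ℓ)
open import Relation.Binary.Definitions using (DecidableEquality)
open import Relation.Binary.PropositionalEquality using (refl; sym; trans; cong; cong₂; subst; subst₂; module ≡-Reasoning)
open import Relation.Nullary using (does; yes; no)
open import Relation.Nullary.Decidable using (does-⇔)
open import Relation.Unary using (Pred; Decidable)

open ≡-Reasoning

-- Colour D(m, n) by vectors of 𝔽₂ᵏ (identified with Fin (2 ^ k)), the colour of a vertex being the sum of
-- labels of its coordinates: a K₄ coordinate y is labelled by a point of the span of a pair (u , w), and a
-- Shrikhande coordinate (a₁ , a₂) by (a₂ mod 2) p plus a point of the span of (u , w).  Along an edge the
-- colour changes by the label difference in one coordinate, and at every vertex these differences are the
-- points u, w, u ⊕ w of the "line" (u , w) of a K₄ factor, resp. the points of the two lines (p , u) and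
-- (p , w) of a Shrikhande factor.  Hence the colouring is perfect with quotient matrix (i , j) ↦ number of
-- points equal to i ⊕ j, and the theorem reduces to finding line systems covering 𝔽₂ᵏ uniformly three
-- times (3J), resp. 𝔽₂ᵏ ∖ 0 three times and 0 never (3(J − E)); a Shrikhande factor may always be traded
-- for two K₄ factors.  Such systems are written down for k = 2, 3 and lifted from 𝔽₂ᵏ to 𝔽₄ ⊕ 𝔽₂ᵏ by
-- replacing a line (u , w) by the four lines ((s , u) , (ω s , w)), s ∈ 𝔽₄: since s ↦ s, ω s, ω² s
-- are bijections of 𝔽₄, they cover (t , x) exactly as often as (u , w) covers x.

Bits : ℕ → Set
Bits k = Vec Bool k

infixl 6 _⊕_
_⊕_ : ∀ {k} → Bits k → Bits k → Bits k
_⊕_ = zipWith _xor_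

zeros : ∀ {k} → Bits k
zeros = replicate _ false

⊕-self : ∀ {k} (a : Bits k) → a ⊕ a ≡ zeros
⊕-self []      = refl
⊕-self (b ∷ a) = cong₂ _∷_ (xor-same b) (⊕-self a)

module _ {k : ℕ} where
  ⊕-assoc : (a b c : Bits k) → (a ⊕ b) ⊕ c ≡ a ⊕ (b ⊕ c)
  ⊕-assoc a b c = Pointwise.Pointwise-≡⇒≡ (Pointwise.zipWith-assoc xor-assoc a b c)

  ⊕-comm : (a b : Bits k) → a ⊕ b ≡ b ⊕ a
  ⊕-comm a b = Pointwise.Pointwise-≡⇒≡ (Pointwise.zipWith-comm xor-comm a b)

  ⊕-identityˡ : (a : Bits k) → zeros ⊕ a ≡ a
  ⊕-identityˡ a = Pointwise.Pointwise-≡⇒≡ (Pointwise.zipWith-identityˡ xor-identityˡ a)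

  ⊕-identityʳ : (a : Bits k) → a ⊕ zeros ≡ a
  ⊕-identityʳ a = Pointwise.Pointwise-≡⇒≡ (Pointwise.zipWith-identityʳ xor-identityʳ a)

  ⊕-cancelˡ : (a b : Bits k) → a ⊕ (a ⊕ b) ≡ b
  ⊕-cancelˡ a b = begin
    a ⊕ (a ⊕ b)  ≡⟨ sym (⊕-assoc a a b) ⟩
    (a ⊕ a) ⊕ b  ≡⟨ cong (_⊕ b) (⊕-self a) ⟩
    zeros ⊕ b    ≡⟨ ⊕-identityˡ b ⟩
    b            ∎

  ⊕-interchange : (a b c d : Bits k) → (a ⊕ b) ⊕ (c ⊕ d) ≡ (a ⊕ c) ⊕ (b ⊕ d)
  ⊕-interchange a b c d = begin
    (a ⊕ b) ⊕ (c ⊕ d)  ≡⟨ ⊕-assoc a b (c ⊕ d) ⟩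
    a ⊕ (b ⊕ (c ⊕ d))  ≡⟨ cong (a ⊕_) (sym (⊕-assoc b c d)) ⟩
    a ⊕ ((b ⊕ c) ⊕ d)  ≡⟨ cong (λ z → a ⊕ (z ⊕ d)) (⊕-comm b c) ⟩
    a ⊕ ((c ⊕ b) ⊕ d)  ≡⟨ cong (a ⊕_) (⊕-assoc c b d) ⟩
    a ⊕ (c ⊕ (b ⊕ d))  ≡⟨ sym (⊕-assoc a c (b ⊕ d)) ⟩
    (a ⊕ c) ⊕ (b ⊕ d)  ∎

  ⊕-transpose : {a b e : Bits k} → (a ⊕ b ≡ e) ⇔ (b ≡ a ⊕ e)
  ⊕-transpose {a} {b} {e} = mk⇔
    (λ eq → trans (sym (⊕-cancelˡ a b)) (cong (a ⊕_) eq))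
    (λ eq → trans (cong (a ⊕_) eq) (⊕-cancelˡ a e))

infix 4 _≟ᵇ_
_≟ᵇ_ : ∀ {k} → DecidableEquality (Bits k)
_≟ᵇ_ = ≡-dec Bool._≟_

𝟙 : Bool → ℕ
𝟙 true  = 1
𝟙 false = 0

δ : ∀ {k} → Bits k → Bits k → ℕ
δ a b = 𝟙 (does (a ≟ᵇ b))

δ-translate : ∀ {k} (a b e : Bits k) → δ (a ⊕ b) e ≡ δ b (a ⊕ e)
δ-translate a b e = cong 𝟙 (does-⇔ ⊕-transpose (a ⊕ b ≟ᵇ e) (b ≟ᵇ a ⊕ e))

∑ : {A : Set} → List A → (A → ℕ) → ℕ
∑ xs f = sum (map f xs)

syntax ∑ xs (λ x → e) = ∑[ x ∈ xs ] e

∑-++ : {A : Set} (xs ys : List A) (f : A → ℕ) → ∑ (xs List.++ ys) f ≡ ∑ xs f + ∑ ys f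
∑-++ xs ys f = trans (cong sum (map-++ f xs ys)) (sum-++ (map f xs) (map f ys))

∑-cong : {A : Set} {f g : A → ℕ} (xs : List A) → (∀ x → f x ≡ g x) → ∑ xs f ≡ ∑ xs g
∑-cong xs eq = cong sum (map-cong eq xs)

∑-↭ : {A : Set} {xs ys : List A} (f : A → ℕ) → xs ↭ ys → ∑ xs f ≡ ∑ ys f
∑-↭ f xs↭ys = sum-↭ (map⁺ f xs↭ys)

∑-distrib-+ : {A : Set} (xs : List A) (f g : A → ℕ) → ∑[ x ∈ xs ] (f x + g x) ≡ ∑ xs f + ∑ xs g
∑-distrib-+ []       f g = refl
∑-distrib-+ (x ∷ xs) f g = trans (cong (f x + g x +_) (∑-distrib-+ xs f g)) (interchange (f x) (g x) (∑ xs f) (∑ xs g))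
  where
  interchange : ∀ a b c d → (a + b) + (c + d) ≡ (a + c) + (b + d)
  interchange = solve-∀

module _ {A B : Set} where
  ∑-map : (g : A → B) (xs : List A) (f : B → ℕ) → ∑ (map g xs) f ≡ ∑[ x ∈ xs ] f (g x)
  ∑-map g xs f = cong sum (sym (map-∘ xs))

  ∑-concatMap : (g : A → List B) (xs : List A) (f : B → ℕ) → ∑ (concatMap g xs) f ≡ ∑[ x ∈ xs ] ∑ (g x) f
  ∑-concatMap g []       f = refl
  ∑-concatMap g (x ∷ xs) f = trans (∑-++ (g x) (concatMap g xs) f) (cong (∑ (g x) f +_) (∑-concatMap g xs f))

∑-allFin-lookup : {A : Set} (xs : List A) (f : A → ℕ) → ∑[ i ∈ allFin (length xs) ] f (lookup xs i) ≡ ∑ xs f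
∑-allFin-lookup xs f = cong sum (begin
  map (f ∘ lookup xs) (tabulate (λ i → i))  ≡⟨ map-tabulate (λ i → i) (f ∘ lookup xs) ⟩
  tabulate (f ∘ lookup xs)                  ≡⟨ sym (map-tabulate (lookup xs) f) ⟩
  map f (tabulate (lookup xs))              ≡⟨ cong (map f) (tabulate-lookup xs) ⟩
  map f xs                                  ∎)

length-filter : {A : Set} {P : Pred A 0ℓ} (P? : Decidable P) (xs : List A) →
                length (filter P? xs) ≡ ∑[ x ∈ xs ] 𝟙 (does (P? x))
length-filter P? []       = refl
length-filter P? (x ∷ xs) with does (P? x)
... | true  = cong suc (length-filter P? xs)
... | false = length-filter P? xs

filter-witness : {A : Set} {P : Pred A 0ℓ} (P? : Decidable P) (xs : List A) → length (filter P? xs) ≢ 0 → ∃ P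
filter-witness P? []       nonempty = ⊥-elim (nonempty refl)
filter-witness P? (x ∷ xs) nonempty with P? x
... | yes px = x , px
... | no  _  = filter-witness P? xs nonempty

-- Lines, atoms and the points they cover

Line : ℕ → Set
Line k = Bits k × Bits k

Atom : ℕ → Set
Atom k = Bits k × Bits k × Bits k

covLine : ∀ {k} → Line k → Bits k → ℕ
covLine (u , w) d = δ u d + (δ w d + δ (u ⊕ w) d)

atomLines : ∀ {k} → Atom k → List (Line k)
atomLines (p , u , w) = (p , u) ∷ (p , w) ∷ []

covAtom : ∀ {k} → Atom k → Bits k → ℕ
covAtom (p , u , w) d = covLine (p , u) d + covLine (p , w) d

coverage : ∀ {k} → List (Atom k) → List (Line k) → Bits k → ℕ
coverage S K d = ∑[ a ∈ S ] covAtom a d + ∑[ l ∈ K ] covLine l d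

∑-covLine-atomLines : ∀ {k} (a : Atom k) d → ∑[ l ∈ atomLines a ] covLine l d ≡ covAtom a d
∑-covLine-atomLines (p , u , w) d = cong (covLine (p , u) d +_) (+-identityʳ _)

length-concatMap-atomLines : ∀ {k} (S : List (Atom k)) → length (concatMap atomLines S) ≡ 2 * length S
length-concatMap-atomLines []      = refl
length-concatMap-atomLines (a ∷ S) =
  trans (cong (2 +_) (length-concatMap-atomLines S)) (sym (*-suc 2 (length S)))

coverage-trade : ∀ {k} m (S : List (Atom k)) K d →
  coverage (take m S) (concatMap atomLines (drop m S) List.++ K) d ≡ coverage S K d
coverage-trade m S K d = begin
  ∑[ a ∈ take m S ] covAtom a d + ∑[ l ∈ concatMap atomLines (drop m S) List.++ K ] covLine l d
    ≡⟨ cong (∑[ a ∈ take m S ] covAtom a d +_) (∑-++ (concatMap atomLines (drop m S)) K _) ⟩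
  ∑[ a ∈ take m S ] covAtom a d + (∑[ l ∈ concatMap atomLines (drop m S) ] covLine l d + ∑[ l ∈ K ] covLine l d)
    ≡⟨ cong (λ z → ∑[ a ∈ take m S ] covAtom a d + (z + ∑[ l ∈ K ] covLine l d))
            (trans (∑-concatMap atomLines (drop m S) _) (∑-cong (drop m S) (λ a → ∑-covLine-atomLines a d))) ⟩
  ∑[ a ∈ take m S ] covAtom a d + (∑[ a ∈ drop m S ] covAtom a d + ∑[ l ∈ K ] covLine l d)
    ≡⟨ sym (+-assoc (∑[ a ∈ take m S ] covAtom a d) _ _) ⟩
  (∑[ a ∈ take m S ] covAtom a d + ∑[ a ∈ drop m S ] covAtom a d) + ∑[ l ∈ K ] covLine l d
    ≡⟨ cong (_+ ∑[ l ∈ K ] covLine l d)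
            (trans (sym (∑-++ (take m S) (drop m S) _)) (cong (λ T → ∑[ a ∈ T ] covAtom a d) (take++drop≡id m S))) ⟩
  coverage S K d  ∎

-- Bits 2 read as 𝔽₄ = 𝔽₂(ω), ω² = ω + 1, in the basis 1, ω.
pattern 𝟎  = false ∷ false ∷ []
pattern 𝟏  = true  ∷ false ∷ []
pattern ω  = false ∷ true  ∷ []
pattern ω² = true  ∷ true  ∷ []

𝔽₄ : List (Bits 2)
𝔽₄ = 𝟎 ∷ 𝟏 ∷ ω ∷ ω² ∷ []

infixr 7 _·_
_·_ : ∀ {k} → Bool → Bits k → Bits k
true  · v = v
false · v = zeros

comb : ∀ {k r} → Bits r → Vec (Bits k) r → Bits k
comb []       []       = zeros
comb (c ∷ cs) (v ∷ vs) = c · v ⊕ comb cs vs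

·-distrib-xor : ∀ {k} a b (v : Bits k) → (a xor b) · v ≡ a · v ⊕ b · v
·-distrib-xor true  true  v = sym (⊕-self v)
·-distrib-xor true  false v = sym (⊕-identityʳ v)
·-distrib-xor false true  v = sym (⊕-identityˡ v)
·-distrib-xor false false v = sym (⊕-identityˡ zeros)

comb-⊕ : ∀ {k r} (c c′ : Bits r) (vs : Vec (Bits k) r) → comb (c ⊕ c′) vs ≡ comb c vs ⊕ comb c′ vs
comb-⊕ []      []       []       = sym (⊕-identityˡ zeros)
comb-⊕ (a ∷ c) (b ∷ c′) (v ∷ vs) = begin
  (a xor b) · v ⊕ comb (c ⊕ c′) vs            ≡⟨ cong₂ _⊕_ (·-distrib-xor a b v) (comb-⊕ c c′ vs) ⟩
  (a · v ⊕ b · v) ⊕ (comb c vs ⊕ comb c′ vs)  ≡⟨ ⊕-interchange (a · v) (b · v) (comb c vs) (comb c′ vs) ⟩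
  (a · v ⊕ comb c vs) ⊕ (b · v ⊕ comb c′ vs)  ∎

module _ {A : Set} (_+ᴬ_ : A → A → A) (gens : List A) {r : ℕ}
         (coord : A → Bits r) (coefficients : List (Bits r))
         (coord-differences : ∀ z → map (λ s → coord z ⊕ coord (z +ᴬ s)) gens ↭ coefficients) where

  comb-differences : ∀ {k} (vs : Vec (Bits k) r) z d →
    ∑[ s ∈ gens ] δ (comb (coord z) vs ⊕ comb (coord (z +ᴬ s)) vs) d ≡ ∑[ c ∈ coefficients ] δ (comb c vs) d
  comb-differences vs z d = begin
    ∑[ s ∈ gens ] δ (comb (coord z) vs ⊕ comb (coord (z +ᴬ s)) vs) d
      ≡⟨ ∑-cong gens (λ s → cong (λ c → δ c d) (sym (comb-⊕ (coord z) (coord (z +ᴬ s)) vs))) ⟩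
    ∑[ s ∈ gens ] δ (comb (coord z ⊕ coord (z +ᴬ s)) vs) d
      ≡⟨ sym (∑-map (λ s → coord z ⊕ coord (z +ᴬ s)) gens (λ c → δ (comb c vs) d)) ⟩
    ∑[ c ∈ map (λ s → coord z ⊕ coord (z +ᴬ s)) gens ] δ (comb c vs) d
      ≡⟨ ∑-↭ (λ c → δ (comb c vs) d) (coord-differences z) ⟩
    ∑[ c ∈ coefficients ] δ (comb c vs) d  ∎

-- A Gray code, so that each of the steps ±1 in ℤ₄ changes exactly one coordinate.
gray : Z4 → Bits 2
gray 0F = 𝟎
gray 1F = 𝟏
gray 2F = ω²
gray 3F = ω

parity : Z4 → Bool
parity 0F = false
parity 1F = true
parity 2F = false
parity 3F = true

atomCoord : Z4² → Bits 3
atomCoord (a₁ , a₂) = parity a₂ ∷ gray a₁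

lineLabel : ∀ {k} → Line k → Z4 → Bits k
lineLabel (u , w) y = comb (gray y) (u ∷ w ∷ [])

atomLabel : ∀ {k} → Atom k → Z4² → Bits k
atomLabel (p , u , w) z = comb (atomCoord z) (p ∷ u ∷ w ∷ [])

lineCoefficients : List (Bits 2)
lineCoefficients = 𝟏 ∷ ω ∷ ω² ∷ []

atomCoefficients : List (Bits 3)
atomCoefficients = (true ∷ 𝟎) ∷ (true ∷ 𝟎) ∷ (false ∷ 𝟏) ∷ (false ∷ ω) ∷ (true ∷ 𝟏) ∷ (true ∷ ω) ∷ []

gray-differences : ∀ y → map (λ t → gray y ⊕ gray (y +₄ t)) k4Gens ↭ lineCoefficients
gray-differences 0F = ↭-prep _ (↭-swap _ _ ↭-refl)
gray-differences 1F = shift _ (_ ∷ _ ∷ []) []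
gray-differences 2F = ↭-prep _ (↭-swap _ _ ↭-refl)
gray-differences 3F = shift _ (_ ∷ _ ∷ []) []

atomCoord-differences : ∀ z → map (λ s → atomCoord z ⊕ atomCoord (z +₄² s)) shrikhandeGens ↭ atomCoefficients
atomCoord-differences (0F , 0F) = ↭-refl
atomCoord-differences (0F , 1F) = ↭-refl
atomCoord-differences (0F , 2F) = ↭-refl
atomCoord-differences (0F , 3F) = ↭-refl
atomCoord-differences (1F , 0F) = ↭-prep _ (↭-prep _ (↭-swap _ _ (↭-swap _ _ ↭-refl)))
atomCoord-differences (1F , 1F) = ↭-prep _ (↭-prep _ (↭-swap _ _ (↭-swap _ _ ↭-refl)))
atomCoord-differences (1F , 2F) = ↭-prep _ (↭-prep _ (↭-swap _ _ (↭-swap _ _ ↭-refl)))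
atomCoord-differences (1F , 3F) = ↭-prep _ (↭-prep _ (↭-swap _ _ (↭-swap _ _ ↭-refl)))
atomCoord-differences (2F , 0F) = ↭-refl
atomCoord-differences (2F , 1F) = ↭-refl
atomCoord-differences (2F , 2F) = ↭-refl
atomCoord-differences (2F , 3F) = ↭-refl
atomCoord-differences (3F , 0F) = ↭-prep _ (↭-prep _ (↭-swap _ _ (↭-swap _ _ ↭-refl)))
atomCoord-differences (3F , 1F) = ↭-prep _ (↭-prep _ (↭-swap _ _ (↭-swap _ _ ↭-refl)))
atomCoord-differences (3F , 2F) = ↭-prep _ (↭-prep _ (↭-swap _ _ (↭-swap _ _ ↭-refl)))
atomCoord-differences (3F , 3F) = ↭-prep _ (↭-prep _ (↭-swap _ _ (↭-swap _ _ ↭-refl)))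

∑-comb-lineCoefficients : ∀ {k} (u w d : Bits k) →
  ∑[ c ∈ lineCoefficients ] δ (comb c (u ∷ w ∷ [])) d ≡ covLine (u , w) d
∑-comb-lineCoefficients {k} u w d
  rewrite ⊕-identityʳ w | ⊕-identityʳ (zeros {k}) | ⊕-identityʳ u | ⊕-identityˡ w =
  cong (δ u d +_) (cong (δ w d +_) (+-identityʳ _))

∑-comb-atomCoefficients : ∀ {k} (p u w d : Bits k) →
  ∑[ c ∈ atomCoefficients ] δ (comb c (p ∷ u ∷ w ∷ [])) d ≡ covAtom (p , u , w) d
∑-comb-atomCoefficients {k} p u w d
  rewrite ⊕-identityʳ w | ⊕-identityʳ (zeros {k}) | ⊕-identityʳ (zeros {k}) | ⊕-identityʳ p | ⊕-identityʳ u
        | ⊕-identityˡ u | ⊕-identityˡ w | ⊕-identityˡ w =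
  regroup (δ p d) (δ u d) (δ w d) (δ (p ⊕ u) d) (δ (p ⊕ w) d)
  where
  regroup : ∀ P U W A B → P + (P + (U + (W + (A + (B + 0))))) ≡ (P + (U + A)) + (P + (W + B))
  regroup = solve-∀

lineLabel-differences : ∀ {k} (l : Line k) y d →
  ∑[ t ∈ k4Gens ] δ (lineLabel l y ⊕ lineLabel l (y +₄ t)) d ≡ covLine l d
lineLabel-differences (u , w) y d =
  trans (comb-differences _+₄_ k4Gens gray lineCoefficients gray-differences (u ∷ w ∷ []) y d)
        (∑-comb-lineCoefficients u w d)

atomLabel-differences : ∀ {k} (a : Atom k) z d →
  ∑[ s ∈ shrikhandeGens ] δ (atomLabel a z ⊕ atomLabel a (z +₄² s)) d ≡ covAtom a d
atomLabel-differences (p , u , w) z d =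
  trans (comb-differences _+₄²_ shrikhandeGens atomCoord atomCoefficients atomCoord-differences (p ∷ u ∷ w ∷ []) z d)
        (∑-comb-atomCoefficients p u w d)

-- The colouring of D(m, n) defined by atoms and lines

⨁ : ∀ {k m} → (Fin m → Bits k) → Bits k
⨁ {m = zero}  h = zeros
⨁ {m = suc m} h = h zero ⊕ ⨁ (λ i → h (suc i))

⨁-update : ∀ {k m} {A : Set} (H : Fin m → A → Bits k) (x : Fin m → A) (i : Fin m) (g : A → A) →
  ⨁ (λ j → H j (update x i g j)) ≡ ⨁ (λ j → H j (x j)) ⊕ (H i (x i) ⊕ H i (g (x i)))
⨁-update H x zero g = begin
  B ⊕ R              ≡⟨ cong (_⊕ R) (sym (⊕-cancelˡ A B)) ⟩
  (A ⊕ (A ⊕ B)) ⊕ R  ≡⟨ ⊕-assoc A (A ⊕ B) R ⟩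
  A ⊕ ((A ⊕ B) ⊕ R)  ≡⟨ cong (A ⊕_) (⊕-comm (A ⊕ B) R) ⟩
  A ⊕ (R ⊕ (A ⊕ B))  ≡⟨ sym (⊕-assoc A R (A ⊕ B)) ⟩
  (A ⊕ R) ⊕ (A ⊕ B)  ∎
  where
  A = H zero (x zero)
  B = H zero (g (x zero))
  R = ⨁ (λ j → H (suc j) (x (suc j)))
⨁-update H x (suc i) g = trans
  (cong (H zero (x zero) ⊕_) (⨁-update (λ j → H (suc j)) (λ j → x (suc j)) i g))
  (sym (⊕-assoc (H zero (x zero)) _ _))

∑-neighbours : ∀ m n (φ : Vertex m n → ℕ) x y →
  ∑[ w ∈ neighbours m n (x , y) ] φ w ≡
    ∑[ i ∈ allFin m ] ∑[ s ∈ shrikhandeGens ] φ (update x i (_+₄² s) , y) +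
    ∑[ j ∈ allFin n ] ∑[ t ∈ k4Gens ] φ (x , update y j (_+₄ t))
∑-neighbours m n φ x y = trans (∑-++ shrikhandeMoves k4Moves φ)
  (cong₂ _+_ (moves shrikhandeGens (λ i s → update x i (_+₄² s) , y))
             (moves k4Gens (λ j t → x , update y j (_+₄ t))))
  where
  shrikhandeMoves = concatMap (λ i → map (λ s → update x i (_+₄² s) , y) shrikhandeGens) (allFin m)
  k4Moves         = concatMap (λ j → map (λ t → x , update y j (_+₄ t)) k4Gens) (allFin n)
  moves : ∀ {G : Set} {r} (gs : List G) (move : Fin r → G → Vertex m n) →
          ∑ (concatMap (λ i → map (move i) gs) (allFin r)) φ ≡ ∑[ i ∈ allFin r ] ∑[ s ∈ gs ] φ (move i s)
  moves {r = r} gs move = trans (∑-concatMap _ (allFin r) φ) (∑-cong (allFin r) (λ i → ∑-map (move i) gs φ))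

module _ where
  open Inverse 2↔Bool using ()
    renaming (to to toBool; from to fromBool; strictlyInverseˡ to toBool-fromBool; strictlyInverseʳ to fromBool-toBool)

  enc : ∀ {k} → Bits k → Fin (2 ^ k)
  enc []      = zero
  enc (b ∷ x) = combine (fromBool b) (enc x)

  dec : ∀ {k} → Fin (2 ^ k) → Bits k
  dec {zero}  _ = []
  dec {suc k} j = toBool (proj₁ (remQuot {2} (2 ^ k) j)) ∷ dec (proj₂ (remQuot {2} (2 ^ k) j))

  dec-enc : ∀ {k} (x : Bits k) → dec (enc x) ≡ x
  dec-enc []              = refl
  dec-enc {suc k} (b ∷ x) = cong₂ _∷_
    (trans (cong (toBool ∘ proj₁) split) (toBool-fromBool b))
    (trans (cong (dec ∘ proj₂) split) (dec-enc x))
    where split = remQuot-combine {2} {2 ^ k} (fromBool b) (enc x)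

  enc-dec : ∀ {k} (j : Fin (2 ^ k)) → enc {k} (dec j) ≡ j
  enc-dec {zero}  zero = refl
  enc-dec {suc k} j    = trans
    (cong₂ (combine {2} {2 ^ k}) (fromBool-toBool (proj₁ (remQuot {2} (2 ^ k) j))) (enc-dec {k} (proj₂ (remQuot {2} (2 ^ k) j))))
    (combine-remQuot {2} (2 ^ k) j)

does-enc : ∀ {k} (a : Bits k) (j : Fin (2 ^ k)) → does (enc a ≟ j) ≡ does (a ≟ᵇ dec j)
does-enc {k} a j = does-⇔
  (mk⇔ (λ eq → trans (sym (dec-enc a)) (cong dec eq)) (λ eq → trans (cong enc eq) (enc-dec {k} j)))
  (enc a ≟ j) (a ≟ᵇ dec j)

IsEquitable : (m n K : ℕ) → (Vertex m n → Fin K) → (Fin K → Fin K → ℕ) → Set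
IsEquitable m n K c Q = ∀ v j → nbrCount c v j ≡ Q (c v) j

equitable⇒perfect : ∀ {m n K} (c : Vertex m n → Fin K) (Q : Fin K → Fin K → ℕ) →
  IsEquitable m n K c Q → (∀ {i j} → i ≢ j → Q i j ≢ 0) → IsPerfectColoring m n K c Q
equitable⇒perfect {m} {n} c Q equitable offDiagonal = surjective , equitable
  where
  v₀ : Vertex m n
  v₀ = (λ _ → 0F , 0F) , (λ _ → 0F)
  surjective : ∀ j → ∃ λ v → c v ≡ j
  surjective j with c v₀ ≟ j
  ... | yes eq = v₀ , eq
  ... | no neq = filter-witness (λ w → c w ≟ j) (neighbours m n v₀)
                   (λ none → offDiagonal neq (trans (sym (equitable v₀ j)) none))

module DesignColouring {k} (S : List (Atom k)) (K : List (Line k)) where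

  shrikhandePart : (Fin (length S) → Z4²) → Bits k
  shrikhandePart x = ⨁ (λ i → atomLabel (lookup S i) (x i))

  k4Part : (Fin (length K) → Z4) → Bits k
  k4Part y = ⨁ (λ j → lineLabel (lookup K j) (y j))

  colour : Vertex (length S) (length K) → Bits k
  colour (x , y) = shrikhandePart x ⊕ k4Part y

  colour-shrikhande-move : ∀ x y i g →
    colour (update x i g , y) ≡ colour (x , y) ⊕ (atomLabel (lookup S i) (x i) ⊕ atomLabel (lookup S i) (g (x i)))
  colour-shrikhande-move x y i g = begin
    shrikhandePart (update x i g) ⊕ Y  ≡⟨ cong (_⊕ Y) (⨁-update (λ j → atomLabel (lookup S j)) x i g) ⟩
    (X ⊕ Δ) ⊕ Y                        ≡⟨ ⊕-assoc X Δ Y ⟩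
    X ⊕ (Δ ⊕ Y)                        ≡⟨ cong (X ⊕_) (⊕-comm Δ Y) ⟩
    X ⊕ (Y ⊕ Δ)                        ≡⟨ sym (⊕-assoc X Y Δ) ⟩
    (X ⊕ Y) ⊕ Δ                        ∎
    where
    X = shrikhandePart x
    Y = k4Part y
    Δ = atomLabel (lookup S i) (x i) ⊕ atomLabel (lookup S i) (g (x i))

  colour-k4-move : ∀ x y j g →
    colour (x , update y j g) ≡ colour (x , y) ⊕ (lineLabel (lookup K j) (y j) ⊕ lineLabel (lookup K j) (g (y j)))
  colour-k4-move x y j g = trans
    (cong (shrikhandePart x ⊕_) (⨁-update (λ j → lineLabel (lookup K j)) y j g))
    (sym (⊕-assoc (shrikhandePart x) (k4Part y) _))

  colour-neighbours : ∀ v e → ∑[ w ∈ neighbours (length S) (length K) v ] δ (colour w) e ≡ coverage S K (colour v ⊕ e)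
  colour-neighbours (x , y) e = begin
    ∑[ w ∈ neighbours (length S) (length K) (x , y) ] δ (colour w) e
      ≡⟨ ∑-neighbours (length S) (length K) (λ w → δ (colour w) e) x y ⟩
    ∑[ i ∈ allFin (length S) ] ∑[ s ∈ shrikhandeGens ] δ (colour (update x i (_+₄² s) , y)) e +
    ∑[ j ∈ allFin (length K) ] ∑[ t ∈ k4Gens ] δ (colour (x , update y j (_+₄ t))) e
      ≡⟨ cong₂ _+_ (∑-cong (allFin (length S)) shrikhande-moves) (∑-cong (allFin (length K)) k4-moves) ⟩
    ∑[ i ∈ allFin (length S) ] covAtom (lookup S i) d + ∑[ j ∈ allFin (length K) ] covLine (lookup K j) d
      ≡⟨ cong₂ _+_ (∑-allFin-lookup S (λ a → covAtom a d)) (∑-allFin-lookup K (λ l → covLine l d)) ⟩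
    coverage S K d  ∎
    where
    d = colour (x , y) ⊕ e
    shrikhande-moves : ∀ i → ∑[ s ∈ shrikhandeGens ] δ (colour (update x i (_+₄² s) , y)) e ≡ covAtom (lookup S i) d
    shrikhande-moves i = trans
      (∑-cong shrikhandeGens (λ s → trans (cong (λ c → δ c e) (colour-shrikhande-move x y i (_+₄² s)))
                                          (δ-translate (colour (x , y)) _ e)))
      (atomLabel-differences (lookup S i) (x i) d)
    k4-moves : ∀ j → ∑[ t ∈ k4Gens ] δ (colour (x , update y j (_+₄ t))) e ≡ covLine (lookup K j) d
    k4-moves j = trans
      (∑-cong k4Gens (λ t → trans (cong (λ c → δ c e) (colour-k4-move x y j (_+₄ t)))
                                  (δ-translate (colour (x , y)) _ e)))
      (lineLabel-differences (lookup K j) (y j) d)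

  nbrCount-colour : ∀ v j → nbrCount (enc ∘ colour) v j ≡ coverage S K (colour v ⊕ dec j)
  nbrCount-colour v j = begin
    length (filter (λ w → enc (colour w) ≟ j) (neighbours _ _ v))
      ≡⟨ length-filter (λ w → enc (colour w) ≟ j) (neighbours _ _ v) ⟩
    ∑[ w ∈ neighbours _ _ v ] 𝟙 (does (enc (colour w) ≟ j))
      ≡⟨ ∑-cong (neighbours _ _ v) (λ w → cong 𝟙 (does-enc (colour w) j)) ⟩
    ∑[ w ∈ neighbours _ _ v ] δ (colour w) (dec j)
      ≡⟨ colour-neighbours v (dec j) ⟩
    coverage S K (colour v ⊕ dec j)  ∎

  design-colouring : (Q : Fin (2 ^ k) → Fin (2 ^ k) → ℕ) →
    (∀ i j → coverage S K (dec i ⊕ dec j) ≡ Q i j) → (∀ {i j} → i ≢ j → Q i j ≢ 0) →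
    ∃ λ (c : Vertex (length S) (length K) → Fin (2 ^ k)) → IsPerfectColoring (length S) (length K) (2 ^ k) c Q
  design-colouring Q coverage≡Q offDiagonal = enc ∘ colour , equitable⇒perfect (enc ∘ colour) Q equitable offDiagonal
    where
    equitable : IsEquitable (length S) (length K) (2 ^ k) (enc ∘ colour) Q
    equitable v j = begin
      nbrCount (enc ∘ colour) v j                  ≡⟨ nbrCount-colour v j ⟩
      coverage S K (colour v ⊕ dec j)              ≡⟨ cong (λ a → coverage S K (a ⊕ dec j)) (sym (dec-enc (colour v))) ⟩
      coverage S K (dec (enc (colour v)) ⊕ dec j)  ≡⟨ coverage≡Q (enc (colour v)) j ⟩
      Q (enc (colour v)) j                         ∎

2*[1+m]+n≡2+[2*m+n] : ∀ m n → 2 * suc m + n ≡ suc (suc (2 * m + n))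
2*[1+m]+n≡2+[2*m+n] = solve-∀

2m+n≡2L+r⇒m≤L×n≡2[L∸m]+r : ∀ m n L r → r ≤ 1 → 2 * m + n ≡ 2 * L + r → m ≤ L × n ≡ 2 * (L ∸ m) + r
2m+n≡2L+r⇒m≤L×n≡2[L∸m]+r zero    n L       r r≤1 eq = z≤n , eq
2m+n≡2L+r⇒m≤L×n≡2[L∸m]+r (suc m) n zero    r r≤1 eq
  with s≤s () ← subst (_≤ 1) (trans (sym eq) (2*[1+m]+n≡2+[2*m+n] m n)) r≤1
2m+n≡2L+r⇒m≤L×n≡2[L∸m]+r (suc m) n (suc L) r r≤1 eq
  with m≤L , n≡ ← 2m+n≡2L+r⇒m≤L×n≡2[L∸m]+r m n L r r≤1
         (suc-injective (suc-injective (trans (sym (2*[1+m]+n≡2+[2*m+n] m n)) (trans eq (2*[1+m]+n≡2+[2*m+n] L r)))))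
  = s≤s m≤L , n≡

module _ {k} (S : List (Atom k)) (K : List (Line k)) (Q : Fin (2 ^ k) → Fin (2 ^ k) → ℕ)
         (coverage≡Q : ∀ i j → coverage S K (dec i ⊕ dec j) ≡ Q i j)
         (offDiagonal : ∀ {i j} → i ≢ j → Q i j ≢ 0) where

  design-colouring-of-size : ∀ m n → length K ≤ 1 → 2 * m + n ≡ 2 * length S + length K →
    ∃ λ (c : Vertex m n → Fin (2 ^ k)) → IsPerfectColoring m n (2 ^ k) c Q
  design-colouring-of-size m n K≤1 eq
    with m≤L , n≡ ← 2m+n≡2L+r⇒m≤L×n≡2[L∸m]+r m n (length S) (length K) K≤1 eq =
    subst₂ (λ m′ n′ → ∃ λ (c : Vertex m′ n′ → Fin (2 ^ k)) → IsPerfectColoring m′ n′ (2 ^ k) c Q)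
      (trans (length-take m S) (m≤n⇒m⊓n≡m m≤L))
      (trans (length-++ (concatMap atomLines (drop m S)))
             (trans (cong (_+ length K) (trans (length-concatMap-atomLines (drop m S)) (cong (2 *_) (length-drop m S))))
                    (sym n≡)))
      (DesignColouring.design-colouring (take m S) (concatMap atomLines (drop m S) List.++ K) Q
        (λ i j → trans (coverage-trade m S K _) (coverage≡Q i j)) offDiagonal)

-- Lifting atoms from 𝔽₂ᵏ to 𝔽₄ ⊕ 𝔽₂ᵏ

mulω : Bits 2 → Bits 2
mulω (a ∷ b ∷ []) = b ∷ (a xor b) ∷ []

map-mulω-↭ : map mulω 𝔽₄ ↭ 𝔽₄
map-mulω-↭ = ↭-prep 𝟎 (shift 𝟏 (ω ∷ ω² ∷ []) [])

map-mul[1+ω]-↭ : map (λ s → s ⊕ mulω s) 𝔽₄ ↭ 𝔽₄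
map-mul[1+ω]-↭ = ↭-prep 𝟎 (↭-sym (shift ω² (𝟏 ∷ ω ∷ []) []))

∑-prefix : ∀ {k} (v : Bits k) t x → ∑[ s ∈ 𝔽₄ ] δ (s ++ v) (t ++ x) ≡ δ v x
∑-prefix v 𝟎  x = +-identityʳ _
∑-prefix v 𝟏  x = +-identityʳ _
∑-prefix v ω  x = +-identityʳ _
∑-prefix v ω² x = +-identityʳ _

∑-prefix-↭ : ∀ {k} {ts : List (Bits 2)} → ts ↭ 𝔽₄ → ∀ (v : Bits k) t x → ∑[ s ∈ ts ] δ (s ++ v) (t ++ x) ≡ δ v x
∑-prefix-↭ ts↭𝔽₄ v t x = trans (∑-↭ (λ s → δ (s ++ v) (t ++ x)) ts↭𝔽₄) (∑-prefix v t x)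

∑-covLine-lift : ∀ {k} (u w : Bits k) t x → ∑[ s ∈ 𝔽₄ ] covLine (s ++ u , mulω s ++ w) (t ++ x) ≡ covLine (u , w) x
∑-covLine-lift u w t x = begin
  ∑[ s ∈ 𝔽₄ ] (δ (s ++ u) d + (δ (mulω s ++ w) d + δ ((s ++ u) ⊕ (mulω s ++ w)) d))
    ≡⟨ ∑-distrib-+ 𝔽₄ (λ s → δ (s ++ u) d) (λ s → δ (mulω s ++ w) d + δ ((s ++ u) ⊕ (mulω s ++ w)) d) ⟩
  ∑[ s ∈ 𝔽₄ ] δ (s ++ u) d + ∑[ s ∈ 𝔽₄ ] (δ (mulω s ++ w) d + δ ((s ++ u) ⊕ (mulω s ++ w)) d)
    ≡⟨ cong (∑[ s ∈ 𝔽₄ ] δ (s ++ u) d +_)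
            (∑-distrib-+ 𝔽₄ (λ s → δ (mulω s ++ w) d) (λ s → δ ((s ++ u) ⊕ (mulω s ++ w)) d)) ⟩
  ∑[ s ∈ 𝔽₄ ] δ (s ++ u) d + (∑[ s ∈ map mulω 𝔽₄ ] δ (s ++ w) d + ∑[ s ∈ map (λ s → s ⊕ mulω s) 𝔽₄ ] δ (s ++ (u ⊕ w)) d)
    ≡⟨ cong₂ _+_ (∑-prefix u t x) (cong₂ _+_ (∑-prefix-↭ map-mulω-↭ w t x) (∑-prefix-↭ map-mul[1+ω]-↭ (u ⊕ w) t x)) ⟩
  covLine (u , w) x  ∎
  where d = t ++ x

liftAtom : ∀ {k} → Atom k → List (Atom (2 + k))
liftAtom (p , u , w) = map (λ s → s ++ p , mulω s ++ u , mulω s ++ w) 𝔽₄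

liftAtoms : ∀ {k} → List (Atom k) → List (Atom (2 + k))
liftAtoms = concatMap liftAtom

∑-covAtom-liftAtom : ∀ {k} (a : Atom k) t x → ∑[ b ∈ liftAtom a ] covAtom b (t ++ x) ≡ covAtom a x
∑-covAtom-liftAtom (p , u , w) t x = trans
  (∑-distrib-+ 𝔽₄ (λ s → covLine (s ++ p , mulω s ++ u) (t ++ x)) (λ s → covLine (s ++ p , mulω s ++ w) (t ++ x)))
  (cong₂ _+_ (∑-covLine-lift p u t x) (∑-covLine-lift p w t x))

∑-covAtom-liftAtoms : ∀ {k} (S : List (Atom k)) t x → ∑[ b ∈ liftAtoms S ] covAtom b (t ++ x) ≡ ∑[ a ∈ S ] covAtom a x
∑-covAtom-liftAtoms S t x = trans (∑-concatMap liftAtom S _) (∑-cong S (λ a → ∑-covAtom-liftAtom a t x))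

length-liftAtoms : ∀ {k} (S : List (Atom k)) → length (liftAtoms S) ≡ 4 * length S
length-liftAtoms []      = refl
length-liftAtoms (a ∷ S) = trans (cong (4 +_) (length-liftAtoms S)) (sym (*-suc 4 (length S)))

-- In the lift of a system with a single line (u , w), that line is replaced by the three atoms
-- extraAtoms (u , w), which cover the points of (u , w) over all of 𝔽₄ together with (𝔽₄ ∖ 0) ⊕ 0
-- twice, and by prefixLine, which covers (𝔽₄ ∖ 0) ⊕ 0 a third time.

extraAtom : ∀ {k} → Bits 2 → Bits 2 → Bits k → Atom (2 + k)
extraAtom s τ v = s ++ zeros , 𝟎 ++ v , τ ++ v

covAtom-extraAtom : ∀ {k} s τ (v : Bits k) t x → (𝟎 ∷ s ∷ τ ∷ s ⊕ τ ∷ []) ↭ 𝔽₄ →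
  covAtom (extraAtom s τ v) (t ++ x) ≡ 2 * δ (s ++ zeros) (t ++ x) + δ v x
covAtom-extraAtom s τ v t x prefixes↭𝔽₄ = begin
  (A + (δ (𝟎 ++ v) d + δ ((s ++ zeros) ⊕ (𝟎 ++ v)) d)) + (A + (δ (τ ++ v) d + δ ((s ++ zeros) ⊕ (τ ++ v)) d))
    ≡⟨ cong₂ (λ y z → (A + (δ (𝟎 ++ v) d + δ y d)) + (A + (δ (τ ++ v) d + δ z d))) (shifted 𝟎) (shifted τ) ⟩
  (A + (δ (𝟎 ++ v) d + δ ((s ⊕ 𝟎) ++ v) d)) + (A + (δ (τ ++ v) d + δ ((s ⊕ τ) ++ v) d))
    ≡⟨ cong (λ y → (A + (δ (𝟎 ++ v) d + δ (y ++ v) d)) + (A + (δ (τ ++ v) d + δ ((s ⊕ τ) ++ v) d))) (⊕-identityʳ s) ⟩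
  (A + (δ (𝟎 ++ v) d + δ (s ++ v) d)) + (A + (δ (τ ++ v) d + δ ((s ⊕ τ) ++ v) d))
    ≡⟨ regroup A (δ (𝟎 ++ v) d) (δ (s ++ v) d) (δ (τ ++ v) d) (δ ((s ⊕ τ) ++ v) d) ⟩
  2 * A + ∑[ r ∈ 𝟎 ∷ s ∷ τ ∷ s ⊕ τ ∷ [] ] δ (r ++ v) d
    ≡⟨ cong (2 * A +_) (∑-prefix-↭ prefixes↭𝔽₄ v t x) ⟩
  2 * A + δ v x  ∎
  where
  d = t ++ x
  A = δ (s ++ zeros) d
  shifted : ∀ r → (s ++ zeros) ⊕ (r ++ v) ≡ (s ⊕ r) ++ v
  shifted r = trans (zipWith-++ _xor_ s zeros r v) (cong ((s ⊕ r) ++_) (⊕-identityˡ v))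
  regroup : ∀ A B C D E → (A + (B + C)) + (A + (D + E)) ≡ 2 * A + (B + (C + (D + (E + 0))))
  regroup = solve-∀

extraAtoms : ∀ {k} → Line k → List (Atom (2 + k))
extraAtoms (u , w) = extraAtom 𝟏 ω u ∷ extraAtom ω 𝟏 w ∷ extraAtom ω² 𝟏 (u ⊕ w) ∷ []

prefixLine : ∀ {k} → Line (2 + k)
prefixLine = 𝟏 ++ zeros , ω ++ zeros

covLine-prefixLine : ∀ {k} (d : Bits (2 + k)) →
  covLine prefixLine d ≡ δ (𝟏 ++ zeros) d + (δ (ω ++ zeros) d + δ (ω² ++ zeros) d)
covLine-prefixLine d = cong (λ z → δ (𝟏 ++ zeros) d + (δ (ω ++ zeros) d + δ (true ∷ true ∷ z) d)) (⊕-identityˡ zeros)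

∑-covAtom-extraAtoms : ∀ {k} (l : Line k) t x →
  ∑[ a ∈ extraAtoms l ] covAtom a (t ++ x) ≡ covLine l x + 2 * covLine prefixLine (t ++ x)
∑-covAtom-extraAtoms (u , w) t x = begin
  covAtom (extraAtom 𝟏 ω u) d + (covAtom (extraAtom ω 𝟏 w) d + (covAtom (extraAtom ω² 𝟏 (u ⊕ w)) d + 0))
    ≡⟨ cong₂ _+_ (covAtom-extraAtom 𝟏 ω u t x ↭-refl)
                 (cong₂ _+_ (covAtom-extraAtom ω 𝟏 w t x (↭-prep 𝟎 (↭-swap ω 𝟏 ↭-refl)))
                            (cong (_+ 0) (covAtom-extraAtom ω² 𝟏 (u ⊕ w) t x map-mul[1+ω]-↭))) ⟩
  (2 * A₁ + δ u x) + ((2 * A₂ + δ w x) + ((2 * A₃ + δ (u ⊕ w) x) + 0))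
    ≡⟨ regroup A₁ A₂ A₃ (δ u x) (δ w x) (δ (u ⊕ w) x) ⟩
  covLine (u , w) x + 2 * (A₁ + (A₂ + A₃))
    ≡⟨ cong (λ z → covLine (u , w) x + 2 * z) (sym (covLine-prefixLine d)) ⟩
  covLine (u , w) x + 2 * covLine prefixLine d  ∎
  where
  d = t ++ x
  A₁ = δ (𝟏 ++ zeros) d
  A₂ = δ (ω ++ zeros) d
  A₃ = δ (ω² ++ zeros) d
  regroup : ∀ A₁ A₂ A₃ U W X →
    (2 * A₁ + U) + ((2 * A₂ + W) + ((2 * A₃ + X) + 0)) ≡ (U + (W + X)) + 2 * (A₁ + (A₂ + A₃))
  regroup = solve-∀

threeOffZero : ∀ {k} → Bits k → ℕ
threeOffZero d = if does (zeros ≟ᵇ d) then 0 else 3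

threeOffZero-lift : ∀ {k} (t : Bits 2) (x : Bits k) →
  threeOffZero (t ++ x) ≡ threeOffZero x + 3 * covLine prefixLine (t ++ x)
threeOffZero-lift t x = trans (by-prefix t) (cong (λ z → threeOffZero x + 3 * z) (sym (covLine-prefixLine (t ++ x))))
  where
  by-prefix : ∀ (t : Bits 2) → threeOffZero (t ++ x) ≡
    threeOffZero x + 3 * (δ (𝟏 ++ zeros) (t ++ x) + (δ (ω ++ zeros) (t ++ x) + δ (ω² ++ zeros) (t ++ x)))
  by-prefix 𝟎 = sym (+-identityʳ _)
  by-prefix 𝟏 with does (zeros ≟ᵇ x)
  ... | true  = refl
  ... | false = refl
  by-prefix ω with does (zeros ≟ᵇ x)
  ... | true  = refl
  ... | false = refl
  by-prefix ω² with does (zeros ≟ᵇ x)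
  ... | true  = refl
  ... | false = refl

coverage-extend : ∀ {k} (S : List (Atom k)) (l : Line k) → (∀ d → coverage S (l ∷ []) d ≡ threeOffZero d) →
  ∀ t x → coverage (liftAtoms S List.++ extraAtoms l) (prefixLine ∷ []) (t ++ x) ≡ threeOffZero (t ++ x)
coverage-extend S l S-covers t x = begin
  ∑[ a ∈ liftAtoms S List.++ extraAtoms l ] covAtom a d + (Z + 0)
    ≡⟨ cong₂ _+_ (∑-++ (liftAtoms S) (extraAtoms l) _) (+-identityʳ Z) ⟩
  (∑[ a ∈ liftAtoms S ] covAtom a d + ∑[ a ∈ extraAtoms l ] covAtom a d) + Z
    ≡⟨ cong (_+ Z) (cong₂ _+_ (∑-covAtom-liftAtoms S t x) (∑-covAtom-extraAtoms l t x)) ⟩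
  (∑[ a ∈ S ] covAtom a x + (covLine l x + 2 * Z)) + Z
    ≡⟨ regroup (∑[ a ∈ S ] covAtom a x) (covLine l x) Z ⟩
  coverage S (l ∷ []) x + 3 * Z
    ≡⟨ cong (_+ 3 * Z) (S-covers x) ⟩
  threeOffZero x + 3 * Z
    ≡⟨ sym (threeOffZero-lift t x) ⟩
  threeOffZero (t ++ x)  ∎
  where
  d = t ++ x
  Z = covLine prefixLine d
  regroup : ∀ A B Z → (A + (B + 2 * Z)) + Z ≡ (A + (B + 0)) + 3 * Z
  regroup = solve-∀

-- The atom systems

uniformAtoms : ∀ k → List (Atom (2 + k))
uniformAtoms 0 = (𝟎 , 𝟏 , ω) ∷ (ω² , 𝟎 , 𝟏) ∷ []
uniformAtoms 1 =
  (O ∷ O ∷ O ∷ [] , O ∷ O ∷ I ∷ [] , O ∷ I ∷ O ∷ []) ∷ (O ∷ I ∷ I ∷ [] , I ∷ O ∷ O ∷ [] , I ∷ O ∷ O ∷ []) ∷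
  (I ∷ O ∷ I ∷ [] , O ∷ O ∷ O ∷ [] , O ∷ I ∷ I ∷ []) ∷ (I ∷ I ∷ O ∷ [] , O ∷ O ∷ I ∷ [] , O ∷ I ∷ O ∷ []) ∷ []
  where O = false ; I = true
uniformAtoms (suc (suc k)) = liftAtoms (uniformAtoms k)

coverage-uniform : ∀ k d → coverage (uniformAtoms k) [] d ≡ 3
coverage-uniform 0 𝟎  = refl
coverage-uniform 0 𝟏  = refl
coverage-uniform 0 ω  = refl
coverage-uniform 0 ω² = refl
coverage-uniform 1 (false ∷ 𝟎)  = refl
coverage-uniform 1 (false ∷ 𝟏)  = refl
coverage-uniform 1 (false ∷ ω)  = refl
coverage-uniform 1 (false ∷ ω²) = refl
coverage-uniform 1 (true ∷ 𝟎)   = refl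
coverage-uniform 1 (true ∷ 𝟏)   = refl
coverage-uniform 1 (true ∷ ω)   = refl
coverage-uniform 1 (true ∷ ω²)  = refl
coverage-uniform (suc (suc k)) (a ∷ b ∷ x) =
  trans (cong (_+ 0) (∑-covAtom-liftAtoms (uniformAtoms k) (a ∷ b ∷ []) x)) (coverage-uniform k x)

length-uniformAtoms : ∀ k → 2 * length (uniformAtoms k) ≡ 2 ^ (2 + k)
length-uniformAtoms 0 = refl
length-uniformAtoms 1 = refl
length-uniformAtoms (suc (suc k)) = begin
  2 * length (liftAtoms (uniformAtoms k))  ≡⟨ cong (2 *_) (length-liftAtoms (uniformAtoms k)) ⟩
  2 * (4 * L)                              ≡⟨ regroup L ⟩
  2 * (2 * (2 * L))                        ≡⟨ cong (λ z → 2 * (2 * z)) (length-uniformAtoms k) ⟩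
  2 ^ (4 + k)                              ∎
  where
  L = length (uniformAtoms k)
  regroup : ∀ L → 2 * (4 * L) ≡ 2 * (2 * (2 * L))
  regroup = solve-∀

puncturedLine : ∀ k → Line (2 + k)
puncturedAtoms : ∀ k → List (Atom (2 + k))

puncturedLine 0             = 𝟏 , ω
puncturedLine 1             = true ∷ ω , true ∷ 𝟎
puncturedLine (suc (suc k)) = prefixLine

puncturedAtoms 0 = (𝟏 , ω , ω) ∷ []
puncturedAtoms 1 =
  (O ∷ I ∷ O ∷ [] , I ∷ O ∷ O ∷ [] , O ∷ O ∷ I ∷ []) ∷ (I ∷ I ∷ O ∷ [] , O ∷ O ∷ I ∷ [] , O ∷ I ∷ I ∷ []) ∷
  (I ∷ I ∷ I ∷ [] , O ∷ I ∷ I ∷ [] , I ∷ O ∷ I ∷ []) ∷ []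
  where O = false ; I = true
puncturedAtoms (suc (suc k)) = liftAtoms (puncturedAtoms k) List.++ extraAtoms (puncturedLine k)

coverage-punctured : ∀ k d → coverage (puncturedAtoms k) (puncturedLine k ∷ []) d ≡ threeOffZero d
coverage-punctured 0 𝟎  = refl
coverage-punctured 0 𝟏  = refl
coverage-punctured 0 ω  = refl
coverage-punctured 0 ω² = refl
coverage-punctured 1 (false ∷ 𝟎)  = refl
coverage-punctured 1 (false ∷ 𝟏)  = refl
coverage-punctured 1 (false ∷ ω)  = refl
coverage-punctured 1 (false ∷ ω²) = refl
coverage-punctured 1 (true ∷ 𝟎)   = refl
coverage-punctured 1 (true ∷ 𝟏)   = refl
coverage-punctured 1 (true ∷ ω)   = refl
coverage-punctured 1 (true ∷ ω²)  = refl
coverage-punctured (suc (suc k)) (a ∷ b ∷ x) =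
  coverage-extend (puncturedAtoms k) (puncturedLine k) (coverage-punctured k) (a ∷ b ∷ []) x

length-puncturedAtoms : ∀ k → suc (2 * length (puncturedAtoms k) + 1) ≡ 2 ^ (2 + k)
length-puncturedAtoms 0 = refl
length-puncturedAtoms 1 = refl
length-puncturedAtoms (suc (suc k)) = begin
  suc (2 * length (liftAtoms S List.++ extraAtoms (puncturedLine k)) + 1)
    ≡⟨ cong (λ z → suc (2 * z + 1)) (trans (length-++ (liftAtoms S)) (cong (_+ 3) (length-liftAtoms S))) ⟩
  suc (2 * (4 * L + 3) + 1)  ≡⟨ regroup L ⟩
  2 * (2 * suc (2 * L + 1))  ≡⟨ cong (λ z → 2 * (2 * z)) (length-puncturedAtoms k) ⟩
  2 ^ (4 + k)                ∎
  where
  S = puncturedAtoms k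
  L = length S
  regroup : ∀ L → suc (2 * (4 * L + 3) + 1) ≡ 2 * (2 * suc (2 * L + 1))
  regroup = solve-∀

threeOffZero-dec : ∀ {k} (i j : Fin (2 ^ k)) → threeOffZero {k} (dec i ⊕ dec j) ≡ threeJminusE i j
threeOffZero-dec {k} i j = cong (λ b → if b then 0 else 3) (does-⇔ zero⇔equal (zeros ≟ᵇ dec {k} i ⊕ dec j) (i ≟ j))
  where
  zero⇔equal : (zeros ≡ dec {k} i ⊕ dec j) ⇔ (i ≡ j)
  zero⇔equal = mk⇔
    (λ eq → trans (sym (enc-dec {k} i))
              (trans (cong enc (sym (trans (Equivalence.to ⊕-transpose (sym eq)) (⊕-identityʳ (dec {k} i)))))
                     (enc-dec {k} j)))
    (λ { refl → sym (⊕-self (dec {k} i)) })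

threeJminusE-offDiagonal : ∀ {K} {i j : Fin K} → i ≢ j → threeJminusE i j ≢ 0
threeJminusE-offDiagonal {i = i} {j} i≢j with i ≟ j
... | yes i≡j = ⊥-elim (i≢j i≡j)
... | no  _   = λ ()

corollary5 : ∀ (k : ℕ) → 2 ≤ k →
    (∀ (m n : ℕ) → 2 * m + n ≡ 2 ^ k →
      ∃ λ (c : Vertex m n → Fin (2 ^ k)) → IsPerfectColoring m n (2 ^ k) c threeJ)
    ×
    (∀ (m n : ℕ) → 2 * m + n ≡ 2 ^ k ∸ 1 → (0 < m → k ≢ 3) →
      ∃ λ (c : Vertex m n → Fin (2 ^ k)) → IsPerfectColoring m n (2 ^ k) c threeJminusE)
corollary5 zero ()
corollary5 (suc zero) (s≤s ())
corollary5 (suc (suc k)) _ = uniform , punctured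
  where
  uniform : ∀ m n → 2 * m + n ≡ 2 ^ (2 + k) →
    ∃ λ (c : Vertex m n → Fin (2 ^ (2 + k))) → IsPerfectColoring m n (2 ^ (2 + k)) c threeJ
  uniform m n eq = design-colouring-of-size (uniformAtoms k) [] threeJ
    (λ i j → coverage-uniform k (dec i ⊕ dec j)) (λ _ ()) m n z≤n
    (trans eq (trans (sym (length-uniformAtoms k)) (sym (+-identityʳ _))))
  punctured : ∀ m n → 2 * m + n ≡ 2 ^ (2 + k) ∸ 1 → (0 < m → 2 + k ≢ 3) →
    ∃ λ (c : Vertex m n → Fin (2 ^ (2 + k))) → IsPerfectColoring m n (2 ^ (2 + k)) c threeJminusE
  punctured m n eq _ = design-colouring-of-size (puncturedAtoms k) (puncturedLine k ∷ []) threeJminusE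
    (λ i j → trans (coverage-punctured k (dec i ⊕ dec j)) (threeOffZero-dec {2 + k} i j)) threeJminusE-offDiagonal
    m n ≤-refl (trans eq (cong (_∸ 1) (sym (length-puncturedAtoms k))))
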